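{- Let $m$ be an integer and write $m=4b+r$ with $b\in\mathbb{Z}$ and $0\le r\le 3$. For every $t\ge 5$ and every integer $k$, $k^2+3+8m$ is a square modulo $2^t$ if and only if $k\equiv \pm(4r+1) \bmod 16$.
   Context: An integer $c$ is a square modulo $N$ if $c\equiv x^2 \bmod N$ for some integer $x$. -}

module Defs where

open import Data.Integer using (ℤ; _-_; _*_)
open import Data.Integer.Divisibility using (_∣_)
open import Data.Product using (∃-syntax)

IsSquareMod : ℤ → ℤ → Set
IsSquareMod c N = ∃[ x ] (N ∣ (c - x * x))

_≡_[mod_] : ℤ → ℤ → ℤ → Set
a ≡ b [mod N ] = N ∣ (a - b)

{-# OPTIONS --safe #-}

-- Modulo 32, k² + 3 + 8m depends only on k mod 16 and r = m mod 4, and a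
-- finite check shows it is a square mod 32 only when k ≡ ±(4r+1) (mod 16). Conversely, for such k
-- it is ≡ (4r+1)² + 3 + 8r = 4 + 16r(r+1) ≡ 4 (mod 32), i.e. 4d with d ≡ 1 (mod 8), and such d is an
-- odd square modulo every power of 2 by Hensel lifting.

module Submission where

open import Defs
open import Data.Nat as ℕ using (ℕ; zero; suc; _≤_; s≤s)
open import Data.Nat.Properties using (allUpTo?; m≤n⇒∃[o]m+o≡n)
open import Data.Integer using (ℤ; NonZero; +_; -_; _+_; _-_; _*_; _^_; _%_; _/_)
open import Data.Integer.Properties using (pos-+; +-identityˡ)
open import Data.Integer.DivMod using (a≡a%n+[a/n]*n; n%d<d)
open import Data.Integer.Divisibility.Signed
  using (_∣_; divides; _∣?_; ∣ᵤ⇒∣; ∣⇒∣ᵤ; ∣-trans; ∣m∣n⇒∣m+n; ∣m⇒∣-m; *-monoʳ-∣)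
open import Data.Integer.Tactic.RingSolver using (solve-∀)
open import Data.Product using (∃-syntax; _×_; _,_)
open import Data.Sum using (_⊎_; inj₁; inj₂; map)
open import Function.Bundles using (_⇔_; mk⇔)
open import Relation.Nullary.Decidable using (Dec; _→-dec_; _⊎-dec_; toWitness)
open import Relation.Binary.PropositionalEquality using (_≡_; refl; trans; cong; subst)
open Relation.Binary.PropositionalEquality.≡-Reasoning

Q : ℤ → ℤ → ℤ
Q k m = k * k + + 3 + + 8 * m

4r+1 : ℕ → ℤ
4r+1 r = + 4 * + r + + 1

infix 4 _≡±[4_+1]-mod-16

_≡±[4_+1]-mod-16 : ℤ → ℕ → Set
k ≡±[4 r +1]-mod-16 = + 16 ∣ k - 4r+1 r ⊎ + 16 ∣ k - - 4r+1 r

≡-mod-trans : ∀ {n a b c} → n ∣ a - b → n ∣ b - c → n ∣ a - c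
≡-mod-trans {n} {a} {b} {c} a≡b b≡c = subst (n ∣_) (telescope a b c) (∣m∣n⇒∣m+n a≡b b≡c)
  where
  telescope : ∀ a b c → (a - b) + (b - c) ≡ a - c
  telescope = solve-∀

≡-mod-sym : ∀ {n a b} → n ∣ a - b → n ∣ b - a
≡-mod-sym {n} {a} {b} a≡b = subst (n ∣_) (negate a b) (∣m⇒∣-m a≡b)
  where
  negate : ∀ a b → - (a - b) ≡ b - a
  negate = solve-∀

≡-mod-% : ∀ a n .{{_ : NonZero n}} → n ∣ a - + (a % n)
≡-mod-% a n = divides (a / n) (begin
  a - + (a % n)                        ≡⟨ cong (_- + (a % n)) (a≡a%n+[a/n]*n a n) ⟩
  (+ (a % n) + (a / n) * n) - + (a % n) ≡⟨ cancel (+ (a % n)) ((a / n) * n) ⟩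
  (a / n) * n                           ∎)
  where
  cancel : ∀ x y → (x + y) - x ≡ y
  cancel = solve-∀

square-≡-mod-double : ∀ {n a b} → + 2 * n ∣ a - b → + 4 * n ∣ a * a - b * b
square-≡-mod-double {n} {a} {b} (divides q a-b≡) = divides (q * (b + q * n)) (begin
  a * a - b * b                            ≡⟨ factor a b ⟩
  (a - b) * ((a - b) + + 2 * b)            ≡⟨ cong (λ d → d * (d + + 2 * b)) a-b≡ ⟩
  q * (+ 2 * n) * (q * (+ 2 * n) + + 2 * b) ≡⟨ regroup q n b ⟩
  q * (b + q * n) * (+ 4 * n)              ∎)
  where
  factor : ∀ a b → a * a - b * b ≡ (a - b) * ((a - b) + + 2 * b)
  factor = solve-∀
  regroup : ∀ q n b → q * (+ 2 * n) * (q * (+ 2 * n) + + 2 * b) ≡ q * (b + q * n) * (+ 4 * n)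
  regroup = solve-∀

2∣n*[n+1] : ∀ n → + 2 ∣ + n * (+ n + + 1)
2∣n*[n+1] zero = divides (+ 0) refl
2∣n*[n+1] (suc n) with divides T eq ← 2∣n*[n+1] n = divides (T + + n + + 1) (begin
  + suc n * (+ suc n + + 1)             ≡⟨ cong (λ s → s * (s + + 1)) (pos-+ 1 n) ⟩
  (+ 1 + + n) * ((+ 1 + + n) + + 1)     ≡⟨ step (+ n) ⟩
  + n * (+ n + + 1) + (+ n + + 1) * + 2 ≡⟨ cong (_+ (+ n + + 1) * + 2) eq ⟩
  T * + 2 + (+ n + + 1) * + 2           ≡⟨ collect T (+ n) ⟩
  (T + + n + + 1) * + 2                 ∎)
  where
  step : ∀ n → (+ 1 + n) * ((+ 1 + n) + + 1) ≡ n * (n + + 1) + (n + + 1) * + 2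
  step = solve-∀
  collect : ∀ T n → T * + 2 + (n + + 1) * + 2 ≡ (T + n + + 1) * + 2
  collect = solve-∀

even-or-odd : ∀ q → ∃[ h ] (q ≡ h * + 2 ⊎ q ≡ + 1 + h * + 2)
even-or-odd q with q % + 2 | n%d<d q (+ 2) | a≡a%n+[a/n]*n q (+ 2)
... | 0 | _ | q≡ = q / + 2 , inj₁ (trans q≡ (+-identityˡ _))
... | 1 | _ | q≡ = q / + 2 , inj₂ q≡
... | suc (suc _) | s≤s (s≤s ()) | _

-- For odd q, moving x to x + 2^(e+2) shifts x² by 2^(e+3)·x mod 2^(e+4), absorbing q as x is odd.
odd-square-lift : ∀ e {d w} → + 8 * (+ 2) ^ e ∣ d - (+ 1 + + 2 * w) * (+ 1 + + 2 * w) →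
                  ∃[ w′ ] (+ 8 * (+ 2) ^ suc e ∣ d - (+ 1 + + 2 * w′) * (+ 1 + + 2 * w′))
odd-square-lift e {d} {w} (divides q eq) with even-or-odd q
... | h , inj₁ q≡2h = w , divides h (begin
  d - (+ 1 + + 2 * w) * (+ 1 + + 2 * w) ≡⟨ eq ⟩
  q * (+ 8 * P)                        ≡⟨ cong (_* (+ 8 * P)) q≡2h ⟩
  h * + 2 * (+ 8 * P)                  ≡⟨ regroup h P ⟩
  h * (+ 8 * (+ 2 * P))                ∎)
  where
  P = (+ 2) ^ e
  regroup : ∀ h P → h * + 2 * (+ 8 * P) ≡ h * (+ 8 * (+ 2 * P))
  regroup = solve-∀
... | h , inj₂ q≡1+2h = w + + 2 * P , divides (h - w - P) (begin
  d - x′ * x′                                         ≡⟨ split d w P ⟩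
  (d - x * x) - (x′ * x′ - x * x)                     ≡⟨ cong (λ D → D - (x′ * x′ - x * x)) eq ⟩
  q * (+ 8 * P) - (x′ * x′ - x * x)                   ≡⟨ cong (λ q → q * (+ 8 * P) - (x′ * x′ - x * x)) q≡1+2h ⟩
  (+ 1 + h * + 2) * (+ 8 * P) - (x′ * x′ - x * x)     ≡⟨ collect h w P ⟩
  (h - w - P) * (+ 8 * (+ 2 * P))                     ∎)
  where
  P = (+ 2) ^ e
  x = + 1 + + 2 * w
  x′ = + 1 + + 2 * (w + + 2 * P)
  split : ∀ d w P → d - (+ 1 + + 2 * (w + + 2 * P)) * (+ 1 + + 2 * (w + + 2 * P))
        ≡ (d - (+ 1 + + 2 * w) * (+ 1 + + 2 * w))
          - ((+ 1 + + 2 * (w + + 2 * P)) * (+ 1 + + 2 * (w + + 2 * P)) - (+ 1 + + 2 * w) * (+ 1 + + 2 * w))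
  split = solve-∀
  collect : ∀ h w P → (+ 1 + h * + 2) * (+ 8 * P)
            - ((+ 1 + + 2 * (w + + 2 * P)) * (+ 1 + + 2 * (w + + 2 * P)) - (+ 1 + + 2 * w) * (+ 1 + + 2 * w))
          ≡ (h - w - P) * (+ 8 * (+ 2 * P))
  collect = solve-∀

≡1-mod-8⇒odd-square-mod-2^ : ∀ e {d} → + 8 ∣ d - + 1 →
                              ∃[ w ] (+ 8 * (+ 2) ^ e ∣ d - (+ 1 + + 2 * w) * (+ 1 + + 2 * w))
≡1-mod-8⇒odd-square-mod-2^ zero    d≡1 = + 0 , d≡1
≡1-mod-8⇒odd-square-mod-2^ (suc e) {d} d≡1
  with w , sq ← ≡1-mod-8⇒odd-square-mod-2^ e {d} d≡1 = odd-square-lift e {d} {w} sq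

≡4-mod-32⇒square-mod-2^ : ∀ e {c} → + 32 ∣ c - + 4 → IsSquareMod c ((+ 2) ^ (5 ℕ.+ e))
≡4-mod-32⇒square-mod-2^ e {c} (divides q c≡4) =
  double-root (≡1-mod-8⇒odd-square-mod-2^ e {d} (divides q (cancel q)))
  where
  d = + 1 + q * + 8
  cancel : ∀ q → (+ 1 + q * + 8) - + 1 ≡ q * + 8
  cancel = solve-∀
  shift : ∀ c y → c - y ≡ ((c - + 4) + + 4) - y
  shift = solve-∀
  factor : ∀ q x → (q * + 32 + + 4) - + 2 * x * (+ 2 * x) ≡ + 4 * ((+ 1 + q * + 8) - x * x)
  factor = solve-∀
  power : ∀ P s → + 4 * (s * (+ 8 * P)) ≡ s * (+ 2 * (+ 2 * (+ 2 * (+ 2 * (+ 2 * P)))))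
  power = solve-∀
  double-root : ∃[ w ] (+ 8 * (+ 2) ^ e ∣ d - (+ 1 + + 2 * w) * (+ 1 + + 2 * w)) →
              IsSquareMod c ((+ 2) ^ (5 ℕ.+ e))
  double-root (w , divides s d≡x²) = + 2 * x , ∣⇒∣ᵤ (divides s (begin
    c - + 2 * x * (+ 2 * x)                 ≡⟨ shift c (+ 2 * x * (+ 2 * x)) ⟩
    ((c - + 4) + + 4) - + 2 * x * (+ 2 * x) ≡⟨ cong (λ D → (D + + 4) - + 2 * x * (+ 2 * x)) c≡4 ⟩
    (q * + 32 + + 4) - + 2 * x * (+ 2 * x)  ≡⟨ factor q x ⟩
    + 4 * (d - x * x)                       ≡⟨ cong (+ 4 *_) d≡x² ⟩
    + 4 * (s * (+ 8 * (+ 2) ^ e))           ≡⟨ power ((+ 2) ^ e) s ⟩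
    s * (+ 2) ^ (5 ℕ.+ e)                   ∎))
    where
    x = + 1 + + 2 * w

IsSquareMod-∣ : ∀ {M N c} → M ∣ N → IsSquareMod c N → IsSquareMod c M
IsSquareMod-∣ {M} {N} {c} M∣N (x , N∣c-x²) = x , ∣⇒∣ᵤ (∣-trans M∣N (∣ᵤ⇒∣ {N} {c - x * x} N∣c-x²))

IsSquareMod-resp : ∀ {N c c′} → N ∣ c - c′ → IsSquareMod c N → IsSquareMod c′ N
IsSquareMod-resp {N} {c} {c′} c≡c′ (x , N∣c-x²) =
  x , ∣⇒∣ᵤ (≡-mod-trans {N} {c′} {c} (≡-mod-sym {N} {c} c≡c′) (∣ᵤ⇒∣ {N} {c - x * x} N∣c-x²))

IsSquareMod-32⇒root<16 : ∀ {c} → IsSquareMod c (+ 32) → ∃[ j ] (j ℕ.< 16 × + 32 ∣ c - + j * + j)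
IsSquareMod-32⇒root<16 {c} (x , 32∣c-x²) =
  x % + 16 , n%d<d x (+ 16) ,
  ≡-mod-trans {a = c} {b = x * x} (∣ᵤ⇒∣ {+ 32} {c - x * x} 32∣c-x²)
              (square-≡-mod-double {+ 8} {x} {+ (x % + 16)} (≡-mod-% x (+ 16)))

32∣2^[5+e] : ∀ e → + 32 ∣ (+ 2) ^ (5 ℕ.+ e)
32∣2^[5+e] e = divides ((+ 2) ^ e) (power ((+ 2) ^ e))
  where
  power : ∀ P → + 2 * (+ 2 * (+ 2 * (+ 2 * (+ 2 * P)))) ≡ P * + 32
  power = solve-∀

Q-cong : ∀ {k k₀ m r} → + 16 ∣ k - k₀ → + 4 ∣ m - r → + 32 ∣ Q k m - Q k₀ r
Q-cong {k} {k₀} {m} {r} k≡k₀ m≡r =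
  subst (+ 32 ∣_) (rearrange k k₀ m r)
        (∣m∣n⇒∣m+n (square-≡-mod-double {+ 8} {k} {k₀} k≡k₀) (*-monoʳ-∣ (+ 8) m≡r))
  where
  rearrange : ∀ k k₀ m r → (k * k - k₀ * k₀) + + 8 * (m - r)
            ≡ (k * k + + 3 + + 8 * m) - (k₀ * k₀ + + 3 + + 8 * r)
  rearrange = solve-∀

square-residues-mod-32 : ∀ {r} → r ℕ.< 4 → ∀ {i} → i ℕ.< 16 → ∀ {j} → j ℕ.< 16 →
                         + 32 ∣ Q (+ i) (+ r) - + j * + j → + i ≡±[4 r +1]-mod-16
square-residues-mod-32 =
  toWitness {a? = allUpTo? (λ r → allUpTo? (λ i → allUpTo? (check r i) 16) 16) 4} _
  where
  check : ∀ r i j → Dec (+ 32 ∣ Q (+ i) (+ r) - + j * + j → + i ≡±[4 r +1]-mod-16)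
  check r i j = (+ 32 ∣? Q (+ i) (+ r) - + j * + j)
                →-dec ((+ 16 ∣? + i - 4r+1 r) ⊎-dec (+ 16 ∣? + i - - 4r+1 r))

IsSquareMod-32⇒≡±[4r+1]-mod-16 : ∀ {k m r} → r ℕ.< 4 → + 4 ∣ m - + r →
                                  IsSquareMod (Q k m) (+ 32) → k ≡±[4 r +1]-mod-16
IsSquareMod-32⇒≡±[4r+1]-mod-16 {k} {m} {r} r<4 m≡r sq =
  from-residue (IsSquareMod-32⇒root<16 {Q k₀ (+ r)}
                 (IsSquareMod-resp {+ 32} {Q k m} (Q-cong {k} {k₀} {m} k≡k₀ m≡r) sq))
  where
  k₀ = + (k % + 16)
  k≡k₀ : + 16 ∣ k - k₀
  k≡k₀ = ≡-mod-% k (+ 16)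
  from-residue : ∃[ j ] (j ℕ.< 16 × + 32 ∣ Q k₀ (+ r) - + j * + j) → k ≡±[4 r +1]-mod-16
  from-residue (j , j<16 , sq₀) =
    map (≡-mod-trans {a = k} {b = k₀} k≡k₀) (≡-mod-trans {a = k} {b = k₀} k≡k₀)
        (square-residues-mod-32 r<4 (n%d<d k (+ 16)) j<16 sq₀)

Q[4r+1,r]≡4-mod-32 : ∀ r → + 32 ∣ Q (4r+1 r) (+ r) - + 4
Q[4r+1,r]≡4-mod-32 r = subst (+ 32 ∣_) (expand (+ r)) (*-monoʳ-∣ (+ 16) (2∣n*[n+1] r))
  where
  expand : ∀ R → + 16 * (R * (R + + 1)) ≡ ((+ 4 * R + + 1) * (+ 4 * R + + 1) + + 3 + + 8 * R) - + 4
  expand = solve-∀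

≡±[4r+1]-mod-16⇒Q≡4-mod-32 : ∀ {k m r} → + 4 ∣ m - + r → k ≡±[4 r +1]-mod-16 → + 32 ∣ Q k m - + 4
≡±[4r+1]-mod-16⇒Q≡4-mod-32 {k} {m} {r} m≡r (inj₁ k≡4r+1) =
  ≡-mod-trans {a = Q k m} (Q-cong {k} {4r+1 r} {m} k≡4r+1 m≡r) (Q[4r+1,r]≡4-mod-32 r)
≡±[4r+1]-mod-16⇒Q≡4-mod-32 {k} {m} {r} m≡r (inj₂ k≡-[4r+1]) =
  ≡-mod-trans {a = Q k m} (Q-cong {k} { - 4r+1 r} {m} k≡-[4r+1] m≡r)
              (subst (λ c → + 32 ∣ c - + 4) (Q-neg (4r+1 r) (+ r)) (Q[4r+1,r]≡4-mod-32 r))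
  where
  Q-neg : ∀ a m → a * a + + 3 + + 8 * m ≡ - a * - a + + 3 + + 8 * m
  Q-neg = solve-∀

lemma3p2 : (m b : ℤ) (r : ℕ) → r ≤ 3 → m ≡ + 4 * b + + r →
    (t : ℕ) → 5 ≤ t → (k : ℤ) →
    IsSquareMod (k * k + + 3 + + 8 * m) ((+ 2) ^ t)
    ⇔ (k ≡ + 4 * + r + + 1 [mod + 16 ] ⊎ k ≡ - (+ 4 * + r + + 1) [mod + 16 ])
lemma3p2 .(+ 4 * b + + r) b r r≤3 refl t 5≤t k with e , refl ← m≤n⇒∃[o]m+o≡n 5≤t =
  mk⇔ (λ sq → map ∣⇒∣ᵤ ∣⇒∣ᵤ (IsSquareMod-32⇒≡±[4r+1]-mod-16 {k} {m} (s≤s r≤3) m≡r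
                                (IsSquareMod-∣ {c = Q k m} (32∣2^[5+e] e) sq)))
      (λ res → ≡4-mod-32⇒square-mod-2^ e {Q k m} (≡±[4r+1]-mod-16⇒Q≡4-mod-32 {k} {m} m≡r
                                           (map (∣ᵤ⇒∣ {i = k - 4r+1 r}) (∣ᵤ⇒∣ {i = k - - 4r+1 r}) res)))
  where
  m = + 4 * b + + r
  m≡r : + 4 ∣ m - + r
  m≡r = divides b (cancel (+ r) b)
    where
    cancel : ∀ y b → (+ 4 * b + y) - y ≡ b * + 4
    cancel = solve-∀
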